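{- Let $\pi$ be a $312$-avoiding permutation. Then every $\mathrm{nw}$ stripe of $\pi$ is descending from left to right, i.e. if $(i,\pi_i)$ and $(j,\pi_j)$ lie in the same $\mathrm{nw}$ stripe and $i<j$, then $\pi_i>\pi_j$.
   Context: For $\pi\in S_n$ with plot $\{(i,\pi_i)\}$, $\pi$ avoids $312$ if there are no $a<b<c$ with $\pi_b<\pi_c<\pi_a$. A point is a left-to-right maximum if no point to its left is strictly higher. For a point $(i,\pi_i)$ of a $312$-avoiding $\pi$, $\mathrm{nw}(i,\pi_i)$ is the leftmost left-to-right maximum $(j,\pi_j)$ with $j\leq i$ and $\pi_j\geq\pi_i$. The $\mathrm{nw}$ stripe of a point $p$ is the set $\{q:\mathrm{nw}(q)=\mathrm{nw}(p)\}$. -}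

module Defs where

open import Data.Nat using (ℕ)
open import Data.Fin using (Fin; _<_; _≤_)
open import Data.Fin.Permutation using (Permutation′; _⟨$⟩ʳ_)
open import Data.Product using (_×_; ∃-syntax)
open import Relation.Nullary using (¬_)

-- A permutation π ∈ S_n, with positions and values in Fin n (0-indexed);
-- π_i is written  π ⟨$⟩ʳ i . Order on Fin is the usual one (via toℕ).

Avoids312 : {n : ℕ} → Permutation′ n → Set
Avoids312 {n} π =
  ¬ (∃[ a ] ∃[ b ] ∃[ c ]
       (a < b × b < c × (π ⟨$⟩ʳ b) < (π ⟨$⟩ʳ c) × (π ⟨$⟩ʳ c) < (π ⟨$⟩ʳ a)))

IsLRMax : {n : ℕ} → Permutation′ n → Fin n → Set
IsLRMax π j = ∀ k → k < j → ¬ ((π ⟨$⟩ʳ j) < (π ⟨$⟩ʳ k))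

IsNW : {n : ℕ} → Permutation′ n → Fin n → Fin n → Set
IsNW π i j =
  IsLRMax π j × j ≤ i × (π ⟨$⟩ʳ i) ≤ (π ⟨$⟩ʳ j) ×
  (∀ k → IsLRMax π k → k ≤ i → (π ⟨$⟩ʳ i) ≤ (π ⟨$⟩ʳ k) → j ≤ k)

SameStripe : {n : ℕ} → Permutation′ n → Fin n → Fin n → Set
SameStripe π p q = ∃[ j ] (IsNW π p j × IsNW π q j)

module Submission where

-- If (i, π_i) and (j, π_j) lie in the same nw stripe, they share
-- the point m = nw(i) = nw(j), which satisfies  m ≤ i,  π_i ≤ π_m  and
-- π_j ≤ π_m : both points lie weakly south-east of one common point.  So it
-- suffices to prove the general fact `descending-below`: in a 312-avoiding
-- permutation, any two points i < j weakly south-east of a common point m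
-- form a descent.  Indeed, π_i = π_j is impossible by injectivity, and if
-- π_i < π_j then m ≠ i (otherwise π_j ≤ π_i), so m < i < j, and π_j < π_m
-- strictly (again by injectivity), so (m, i, j) is a 312 pattern.

open import Defs
open import Data.Nat using (ℕ)
open import Data.Fin using (Fin; _<_; _≤_)
open import Data.Fin.Permutation using (Permutation′; _⟨$⟩ʳ_; _⟨$⟩ˡ_; inverseˡ)
open import Data.Fin.Properties using (<-cmp; ≤∧≢⇒<; <⇒≢)
import Data.Nat.Properties as ℕ
open import Data.Product using (_,_)
open import Data.Empty using (⊥-elim)
open import Relation.Binary.Definitions using (tri<; tri≈; tri>)
open import Relation.Binary.PropositionalEquality
  using (_≡_; refl; sym; cong; module ≡-Reasoning)

⟨$⟩ʳ-injective : {n : ℕ} (π : Permutation′ n) {x y : Fin n} →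
  π ⟨$⟩ʳ x ≡ π ⟨$⟩ʳ y → x ≡ y
⟨$⟩ʳ-injective π {x} {y} πx≡πy = begin
  x                  ≡⟨ sym (inverseˡ π) ⟩
  π ⟨$⟩ˡ (π ⟨$⟩ʳ x)  ≡⟨ cong (π ⟨$⟩ˡ_) πx≡πy ⟩
  π ⟨$⟩ˡ (π ⟨$⟩ʳ y)  ≡⟨ inverseˡ π ⟩
  y                  ∎
  where open ≡-Reasoning

strictly-below : {n : ℕ} (π : Permutation′ n) {x y : Fin n} →
  x < y → π ⟨$⟩ʳ y ≤ π ⟨$⟩ʳ x → π ⟨$⟩ʳ y < π ⟨$⟩ʳ x
strictly-below π x<y πy≤πx =
  ≤∧≢⇒< πy≤πx (λ πy≡πx → <⇒≢ x<y (sym (⟨$⟩ʳ-injective π πy≡πx)))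

descending-below : {n : ℕ} (π : Permutation′ n) → Avoids312 π →
  {m i j : Fin n} → m ≤ i → i < j →
  π ⟨$⟩ʳ i ≤ π ⟨$⟩ʳ m → π ⟨$⟩ʳ j ≤ π ⟨$⟩ʳ m → π ⟨$⟩ʳ j < π ⟨$⟩ʳ i
descending-below π avoids {m} {i} {j} m≤i i<j πi≤πm πj≤πm
  with <-cmp (π ⟨$⟩ʳ j) (π ⟨$⟩ʳ i)
... | tri< πj<πi _ _ = πj<πi
... | tri≈ _ πj≡πi _ = ⊥-elim (<⇒≢ i<j (sym (⟨$⟩ʳ-injective π πj≡πi)))
... | tri> _ _ πi<πj with <-cmp m i
...   | tri> _ _ i<m = ⊥-elim (ℕ.<⇒≱ i<m m≤i)
...   | tri≈ _ refl _ = ⊥-elim (ℕ.<⇒≱ πi<πj πj≤πm)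
...   | tri< m<i _ _ =
  ⊥-elim (avoids (m , i , j , m<i , i<j , πi<πj , πj<πm))
  where
  πj<πm : π ⟨$⟩ʳ j < π ⟨$⟩ʳ m
  πj<πm = strictly-below π (ℕ.<-trans m<i i<j) πj≤πm

proposition6p5 : {n : ℕ} (π : Permutation′ n) → Avoids312 π →
    (i j : Fin n) → SameStripe π i j → i < j → (π ⟨$⟩ʳ j) < (π ⟨$⟩ʳ i)
proposition6p5 π avoids i j (m , (_ , m≤i , πi≤πm , _) , (_ , _ , πj≤πm , _)) i<j =
  descending-below π avoids m≤i i<j πi≤πm πj≤πm
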